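{- The family of braid-simple permutations $(bS_n)_{n\ge1}$ is rare and has exponential growth: $|bS_n|/n!\to0$, and there are constants $a>0$, $b>1$ with $|bS_n|\ge a b^n$ for all $n\ge1$.
   Context: Permutations act on $[n]$; products composed right to left; $\tau_i=(i,i+1)$, $D(k,j)=\tau_k\tau_{k-1}\cdots\tau_j$ for $1\le j\le k\le n-1$. Every $\pi\ne\mathrm{Id}$ has a unique expression $\pi=D(k_1,j_1)\cdots D(k_s,j_s)$ with $1\le k_1<\dots<k_s\le n-1$, $j_a\le k_a$, whose number of letters equals the Coxeter length of $\pi$. $\pi$ is braid-simple ($\pi\in bS_n$) if $\pi=\mathrm{Id}$ or each $\tau_i$ occurs at most once in this word. -}

module Defs where

open import Data.Nat using (ℕ; zero; suc; _∸_; _≡ᵇ_)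
open import Data.Nat.Properties using (_≟_)
open import Data.Bool using (if_then_else_)
open import Data.Product using (_×_; _,_)
open import Data.List using (List; []; _∷_; _++_; map; concatMap; upTo; filter; deduplicate; length)
import Data.List.Properties as LP
open import Data.List.Relation.Unary.Unique.DecPropositional _≟_ using (unique?)
open import Function using (_∘_; id)

-- Adjacent transposition τ_i = (i, i+1), acting on ℕ (points 1..n are used).
τ : ℕ → ℕ → ℕ
τ i x = if x ≡ᵇ i then suc i else (if x ≡ᵇ suc i then i else x)

evalWord : List ℕ → (ℕ → ℕ)
evalWord [] = id
evalWord (i ∷ w) = τ i ∘ evalWord w

-- Letters of D(k,j) = τ_k τ_{k-1} ⋯ τ_j, i.e. the list k, k-1, …, j.
D : ℕ → ℕ → List ℕ
D k j = map (k ∸_) (upTo (suc (k ∸ j)))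

-- All sequences ((k₁,j₁),…,(k_s,j_s)) with 1 ≤ k₁ < ⋯ < k_s ≤ m and 1 ≤ j_a ≤ k_a
-- (including the empty sequence, which represents Id).
canon : ℕ → List (List (ℕ × ℕ))
canon zero = [] ∷ []
canon (suc m) = canon m ++ concatMap (λ w → map (λ j → w ++ ((suc m , suc j) ∷ [])) (upTo (suc m))) (canon m)

letters : List (ℕ × ℕ) → List ℕ
letters [] = []
letters ((k , j) ∷ w) = D k j ++ letters w

oneLine : ℕ → (ℕ → ℕ) → List ℕ
oneLine n f = map (f ∘ suc) (upTo n)

-- The set bS_n (as a duplicate-free list of permutations of [n] in one-line notation):
-- Id together with all π whose canonical word (with k_a ≤ n-1) uses each τ_i at most once.
bSList : ℕ → List (List ℕ)
bSList n = deduplicate (LP.≡-dec _≟_)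
  (map (λ w → oneLine n (evalWord (letters w)))
       (filter (λ w → unique? (letters w)) (canon (n ∸ 1))))

bS : ℕ → ℕ
bS n = length (bSList n)

-- Upper bound: in a braid-simple canonical word the blocks D(k,j) occupy disjoint
-- intervals of letters, so appending a block D(m+1, j+1) to a word on letters ≤ m is
-- only possible when that word uses letters ≤ j.  Hence the number S(m,t) of simple
-- words with k_s ≤ m and all letters ≤ t satisfies S(m+1,t) ≤ S(m,t) + Σ_{j≤m} S(m,j),
-- which gives S(m,t) ≤ 3^min(m,t) and |bS_{m+1}| ≤ 3^m = o((m+1)!).
-- Lower bound: the products of any subset of the commuting transpositions
-- τ_m, τ_{m-2}, τ_{m-4}, … (indices ≥ 2) are braid-simple and pairwise distinct,
-- which gives 2^⌊m/2⌋ elements of bS_{m+1}.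

module Submission where

open import Defs
open import Data.Nat using (ℕ; zero; suc; _+_; _*_; _^_; _⊓_; _≤_; _<_; _!; _∸_; z≤n; s≤s; _≡ᵇ_)
open import Data.Nat.Properties
open import Data.Nat.ListAction using (sum)
open import Data.Nat.ListAction.Properties using (sum-++)
open import Data.Nat.Tactic.RingSolver using (solve-∀)
open import Data.Bool using (true; false; if_then_else_)
open import Data.Empty using (⊥-elim)
open import Data.Product using (_×_; ∃-syntax; _,_)
open import Data.List using (List; []; _∷_; _++_; [_]; map; concatMap; upTo; applyUpTo; filter; length)
import Data.List.Properties as List
open import Data.List.Membership.Propositional using (_∈_)
open import Data.List.Membership.Propositional.Properties
  using (∈-map⁺; ∈-applyUpTo⁺; ∈-++⁺ˡ; ∈-++⁺ʳ; ∈-concat⁺′; ∈-filter⁺; ∈-deduplicate⁺; ∈-∃++)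
open import Data.List.Relation.Unary.Any using (here; there)
open import Data.List.Relation.Unary.All as All using (All; []; _∷_)
import Data.List.Relation.Unary.All.Properties as All
open import Data.List.Relation.Unary.AllPairs as AllPairs using (AllPairs; []; _∷_)
import Data.List.Relation.Unary.AllPairs.Properties as AllPairs
open import Data.List.Relation.Unary.Unique.Propositional using (Unique)
open import Data.List.Relation.Unary.Unique.DecPropositional _≟_ using (unique?)
open import Relation.Nullary using (Dec; yes; no; does; ¬_)
open import Relation.Nullary.Decidable using (_×-dec_; dec-true; dec-false)
open import Relation.Unary using (Pred; Decidable)
open import Relation.Binary.PropositionalEquality using (_≡_; _≢_; refl; sym; trans; cong; cong₂; subst; module ≡-Reasoning)
open import Function using (_∘_)
open import Level using (Level)

private
  variable
    a p q r : Level
    A B : Set a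

indicator : {P : Set p} → Dec P → ℕ
indicator P? = if does P? then 1 else 0

count : {P : Pred A p} → Decidable P → List A → ℕ
count P? xs = sum (map (λ x → indicator (P? x)) xs)

indicator≤1 : {P : Set p} (P? : Dec P) → indicator P? ≤ 1
indicator≤1 (yes _) = ≤-refl
indicator≤1 (no _)  = z≤n

indicator-mono : {P : Set p} {Q : Set q} (P? : Dec P) (Q? : Dec Q) → (P → Q) → indicator P? ≤ indicator Q?
indicator-mono (yes _) (yes _) _   = ≤-refl
indicator-mono (yes p) (no ¬q) P⇒Q = ⊥-elim (¬q (P⇒Q p))
indicator-mono (no _)  _       _   = z≤n

indicator-no : {P : Set p} (P? : Dec P) → ¬ P → indicator P? ≡ 0
indicator-no (yes p) ¬p = ⊥-elim (¬p p)
indicator-no (no _)  _  = refl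

length-filter≡count : {P : Pred A p} (P? : Decidable P) (xs : List A) → length (filter P? xs) ≡ count P? xs
length-filter≡count P? [] = refl
length-filter≡count P? (x ∷ xs) with does (P? x)
... | true  = cong suc (length-filter≡count P? xs)
... | false = length-filter≡count P? xs

sum-map-++ : (f : A → ℕ) (xs ys : List A) → sum (map f (xs ++ ys)) ≡ sum (map f xs) + sum (map f ys)
sum-map-++ f xs ys = trans (cong sum (List.map-++ f xs ys)) (sum-++ (map f xs) (map f ys))

sum-map-concatMap : (f : B → ℕ) (g : A → List B) (xs : List A) →
                    sum (map f (concatMap g xs)) ≡ sum (map (λ x → sum (map f (g x))) xs)
sum-map-concatMap f g []       = refl
sum-map-concatMap f g (x ∷ xs) =
  trans (sum-map-++ f (g x) (concatMap g xs)) (cong (sum (map f (g x)) +_) (sum-map-concatMap f g xs))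

sum-map-map : (f : B → ℕ) (g : A → B) (xs : List A) → sum (map f (map g xs)) ≡ sum (map (f ∘ g) xs)
sum-map-map f g xs = cong sum (sym (List.map-∘ xs))

sum-map-mono : {f g : A → ℕ} {xs : List A} → All (λ x → f x ≤ g x) xs → sum (map f xs) ≤ sum (map g xs)
sum-map-mono []            = z≤n
sum-map-mono (f≤g ∷ fs≤gs) = +-mono-≤ f≤g (sum-map-mono fs≤gs)

sum-map-zero : {f : A → ℕ} {xs : List A} → All (λ x → f x ≡ 0) xs → sum (map f xs) ≡ 0
sum-map-zero []             = refl
sum-map-zero (fx≡0 ∷ fxs≡0) = cong₂ _+_ fx≡0 (sum-map-zero fxs≡0)

sum-map-+ : (f g : A → ℕ) (xs : List A) → sum (map (λ x → f x + g x) xs) ≡ sum (map f xs) + sum (map g xs)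
sum-map-+ f g []       = refl
sum-map-+ f g (x ∷ xs) rewrite sum-map-+ f g xs = interchange (f x) (g x) (sum (map f xs)) (sum (map g xs))
  where
  interchange : ∀ a b c d → a + b + (c + d) ≡ a + c + (b + d)
  interchange = solve-∀

sum-map-swap : (f : A → B → ℕ) (xs : List A) (ys : List B) →
               sum (map (λ x → sum (map (f x) ys)) xs) ≡ sum (map (λ y → sum (map (λ x → f x y) xs)) ys)
sum-map-swap f []       ys = sym (sum-map-zero (All.universal (λ _ → refl) ys))
sum-map-swap f (x ∷ xs) ys = trans (cong (sum (map (f x) ys) +_) (sum-map-swap f xs ys))
                                   (sym (sum-map-+ (f x) (λ y → sum (map (λ x → f x y) xs)) ys))

count-mono : {P : Pred A p} {Q : Pred A q} (P? : Decidable P) (Q? : Decidable Q) {xs : List A} →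
             All (λ x → P x → Q x) xs → count P? xs ≤ count Q? xs
count-mono P? Q? P⇒Q = sum-map-mono (All.map (λ {x} → indicator-mono (P? x) (Q? x)) P⇒Q)

count-none : {P : Pred A p} (P? : Decidable P) {xs : List A} → All (λ x → ¬ P x) xs → count P? xs ≡ 0
count-none P? ¬P = sum-map-zero (All.map (λ {x} → indicator-no (P? x)) ¬P)

geometric-3 : ∀ n → 2 * sum (map (3 ^_) (upTo n)) + 1 ≡ 3 ^ n
geometric-3 zero    = refl
geometric-3 (suc n) = begin
  2 * sum (map (3 ^_) (upTo (suc n))) + 1   ≡⟨ cong (λ js → 2 * sum (map (3 ^_) js) + 1) (sym (List.upTo-∷ʳ n)) ⟩
  2 * sum (map (3 ^_) (upTo n ++ [ n ])) + 1 ≡⟨ cong (λ s → 2 * s + 1) (sum-map-++ (3 ^_) (upTo n) [ n ]) ⟩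
  2 * (s + (3 ^ n + 0)) + 1                 ≡⟨ regroup s (3 ^ n) ⟩
  (2 * s + 1) + 2 * 3 ^ n                   ≡⟨ cong (_+ 2 * 3 ^ n) (geometric-3 n) ⟩
  3 ^ n + 2 * 3 ^ n                         ≡⟨ triple (3 ^ n) ⟩
  3 ^ suc n                                 ∎
  where
  open ≡-Reasoning
  s = sum (map (3 ^_) (upTo n))
  regroup : ∀ s a → 2 * (s + (a + 0)) + 1 ≡ (2 * s + 1) + 2 * a
  regroup = solve-∀
  triple : ∀ a → a + 2 * a ≡ 3 * a
  triple = solve-∀

geometric-3-bound : ∀ m → 3 ^ m + sum (map (3 ^_) (upTo (suc m))) ≤ 3 ^ suc m
geometric-3-bound m = *-cancelˡ-≤ 2 (begin
  2 * (c + s)          ≤⟨ n≤1+n _ ⟩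
  suc (2 * (c + s))    ≡⟨ regroup c s ⟩
  2 * c + (2 * s + 1)  ≡⟨ cong (2 * c +_) (geometric-3 (suc m)) ⟩
  2 * c + 3 * c        ≤⟨ m≤m+n (2 * c + 3 * c) c ⟩
  2 * c + 3 * c + c    ≡⟨ six c ⟩
  2 * (3 * c)          ∎)
  where
  open ≤-Reasoning
  c = 3 ^ m
  s = sum (map (3 ^_) (upTo (suc m)))
  regroup : ∀ c s → suc (2 * (c + s)) ≡ 2 * c + (2 * s + 1)
  regroup = solve-∀
  six : ∀ c → 2 * c + 3 * c + c ≡ 2 * (3 * c)
  six = solve-∀

module _ {R : A → A → Set r} where

  AllPairs-++⁻ˡ : (xs : List A) {ys : List A} → AllPairs R (xs ++ ys) → AllPairs R xs
  AllPairs-++⁻ˡ []       _           = []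
  AllPairs-++⁻ˡ (x ∷ xs) (Rx ∷ Rxs) = All.++⁻ˡ xs Rx ∷ AllPairs-++⁻ˡ xs Rxs

  AllPairs-++⁻-across : (xs : List A) {ys : List A} → AllPairs R (xs ++ ys) → All (λ x → All (R x) ys) xs
  AllPairs-++⁻-across []       _          = []
  AllPairs-++⁻-across (x ∷ xs) (Rx ∷ Rxs) = All.++⁻ʳ xs Rx ∷ AllPairs-++⁻-across xs Rxs

∈-++-∷⁻ : (xs : List A) {ys : List A} {x y : A} → y ∈ xs ++ x ∷ ys → x ≢ y → y ∈ xs ++ ys
∈-++-∷⁻ []       (here y≡x) x≢y = ⊥-elim (x≢y (sym y≡x))
∈-++-∷⁻ []       (there y∈) _   = y∈
∈-++-∷⁻ (_ ∷ xs) (here y≡x) _   = here y≡x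
∈-++-∷⁻ (_ ∷ xs) (there y∈) x≢y = there (∈-++-∷⁻ xs y∈ x≢y)

Unique⇒length≤ : {xs ys : List A} → Unique xs → All (_∈ ys) xs → length xs ≤ length ys
Unique⇒length≤ []                 []              = z≤n
Unique⇒length≤ {xs = x ∷ xs} (x∉xs ∷ xs!) (x∈ys ∷ xs⊆ys) with ∈-∃++ x∈ys
... | ys₁ , ys₂ , refl = begin
  suc (length xs)                ≤⟨ s≤s (Unique⇒length≤ xs! (All.zipWith remove (x∉xs , xs⊆ys))) ⟩
  suc (length (ys₁ ++ ys₂))      ≡⟨ cong suc (List.length-++ ys₁) ⟩
  suc (length ys₁ + length ys₂)  ≡⟨ sym (+-suc (length ys₁) (length ys₂)) ⟩
  length ys₁ + length (x ∷ ys₂)  ≡⟨ sym (List.length-++ ys₁) ⟩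
  length (ys₁ ++ x ∷ ys₂)        ∎
  where
  open ≤-Reasoning
  remove : ∀ {y} → x ≢ y × y ∈ ys₁ ++ x ∷ ys₂ → y ∈ ys₁ ++ ys₂
  remove (x≢y , y∈) = ∈-++-∷⁻ ys₁ y∈ x≢y

Unique-∷ʳ : ∀ {xs : List A} {x} → Unique xs → All (_≢ x) xs → Unique (xs ++ [ x ])
Unique-∷ʳ []           []           = [] ∷ []
Unique-∷ʳ (y∉ys ∷ ys!) (y≢x ∷ ys≢x) = All.++⁺ y∉ys (y≢x ∷ []) ∷ Unique-∷ʳ ys! ys≢x

applyUpTo-≡⇒≡ : (f g : ℕ → A) (n : ℕ) → applyUpTo f n ≡ applyUpTo g n → ∀ {i} → i < n → f i ≡ g i
applyUpTo-≡⇒≡ f g (suc n) eq {zero}  _         = List.∷-injectiveˡ eq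
applyUpTo-≡⇒≡ f g (suc n) eq {suc i} (s≤s i<n) = applyUpTo-≡⇒≡ (f ∘ suc) (g ∘ suc) n (List.∷-injectiveʳ eq) i<n

letters-++ : ∀ w v → letters (w ++ v) ≡ letters w ++ letters v
letters-++ []            v = refl
letters-++ ((k , j) ∷ w) v = trans (cong (D k j ++_) (letters-++ w v)) (sym (List.++-assoc (D k j) (letters w) (letters v)))

evalWord-++ : ∀ u v x → evalWord (u ++ v) x ≡ evalWord u (evalWord v x)
evalWord-++ []      v x = refl
evalWord-++ (i ∷ u) v x = cong (τ i) (evalWord-++ u v x)

⟦_⟧ : List (ℕ × ℕ) → ℕ → ℕ
⟦ w ⟧ = evalWord (letters w)

D-≤ : ∀ k j → All (_≤ k) (D k j)
D-≤ k j = All.map⁺ (All.universal (m∸n≤m k) (upTo (suc (k ∸ j))))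

∈-D : ∀ {k j x} → j ≤ x → x ≤ k → x ∈ D k j
∈-D {k} {j} {x} j≤x x≤k =
  subst (_∈ D k j) (m∸[m∸n]≡n x≤k) (∈-map⁺ (k ∸_) (∈-applyUpTo⁺ (λ i → i) (s≤s (∸-monoʳ-≤ k j≤x))))

D-self : ∀ k → D k k ≡ [ k ]
D-self k rewrite n∸n≡0 k = refl

Letters≤ : ℕ → List (ℕ × ℕ) → Set
Letters≤ t w = All (_≤ t) (letters w)

extend : ℕ → ℕ → List (ℕ × ℕ) → List (ℕ × ℕ)
extend m j w = w ++ [ (suc m , suc j) ]

extensions : ℕ → List (ℕ × ℕ) → List (List (ℕ × ℕ))
extensions m w = map (λ j → extend m j w) (upTo (suc m))

letters-extend : ∀ m j w → letters (extend m j w) ≡ letters w ++ D (suc m) (suc j)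
letters-extend m j w = trans (letters-++ w _) (cong (letters w ++_) (List.++-identityʳ (D (suc m) (suc j))))

Letters≤-extend : ∀ {m} j w → Letters≤ m w → Letters≤ (suc m) (extend m j w)
Letters≤-extend {m} j w w≤m = subst (All (_≤ suc m)) (sym (letters-extend m j w))
  (All.++⁺ (All.map m≤n⇒m≤1+n w≤m) (D-≤ (suc m) (suc j)))

canon-⊆-suc : ∀ m {w} → w ∈ canon m → w ∈ canon (suc m)
canon-⊆-suc m = ∈-++⁺ˡ {xs = canon m}

extend-∈-canon : ∀ {m j w} → j ≤ m → w ∈ canon m → extend m j w ∈ canon (suc m)
extend-∈-canon {m} {j} {w} j≤m w∈ = ∈-++⁺ʳ (canon m)
  (∈-concat⁺′ (∈-map⁺ (λ j → extend m j w) (∈-applyUpTo⁺ (λ i → i) (s≤s j≤m))) (∈-map⁺ (extensions m) w∈))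

canon-Letters≤ : ∀ m → All (Letters≤ m) (canon m)
canon-Letters≤ zero    = [] ∷ []
canon-Letters≤ (suc m) = All.++⁺ (All.map (All.map m≤n⇒m≤1+n) (canon-Letters≤ m))
  (All.concat⁺ (All.map⁺ (All.map (λ {w} w≤m → All.map⁺ (All.universal (λ j → Letters≤-extend j w w≤m) (upTo (suc m))))
                                  (canon-Letters≤ m))))

-- Counting braid-simple canonical words

Simple : ℕ → List (ℕ × ℕ) → Set
Simple t w = Unique (letters w) × Letters≤ t w

Simple? : ∀ t → Decidable (Simple t)
Simple? t w = unique? (letters w) ×-dec All.all? (_≤? t) (letters w)

-- A letter of w above j would occur a second time in D(m+1, j+1).
Simple-extend⁻ : ∀ {m t} j w → Letters≤ m w → Simple t (extend m j w) → Simple j w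
Simple-extend⁻ {m} j w w≤m (unique , _) = AllPairs-++⁻ˡ (letters w) unique′ , All.tabulate below
  where
  unique′ : Unique (letters w ++ D (suc m) (suc j))
  unique′ = subst Unique (letters-extend m j w) unique
  below : ∀ {x} → x ∈ letters w → x ≤ j
  below {x} x∈w with x ≤? j
  ... | yes x≤j = x≤j
  ... | no  x≰j = ⊥-elim (All.lookup (All.lookup (AllPairs-++⁻-across (letters w) unique′) x∈w)
                                     (∈-D (≰⇒> x≰j) (m≤n⇒m≤1+n (All.lookup w≤m x∈w))) refl)

Simple-extend⇒< : ∀ {m t} j w → Simple t (extend m j w) → m < t
Simple-extend⇒< {m} {t} j w (_ , bounded) =
  All.lookup (subst (All (_≤ t)) (letters-extend m j w) bounded) (∈-++⁺ʳ (letters w) (here refl))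

simpleCount : ℕ → ℕ → ℕ
simpleCount m t = count (Simple? t) (canon m)

simpleCount-suc : ∀ m t →
  simpleCount (suc m) t ≡ simpleCount m t + sum (map (λ w → count (Simple? t) (extensions m w)) (canon m))
simpleCount-suc m t = trans (sum-map-++ f (canon m) _) (cong (simpleCount m t +_) (sum-map-concatMap f (extensions m) (canon m)))
  where f = λ w → indicator (Simple? t w)

count-extensions≤ : ∀ m t {w} → Letters≤ m w →
  count (Simple? t) (extensions m w) ≤ count (λ j → Simple? j w) (upTo (suc m))
count-extensions≤ m t {w} w≤m = begin
  count (Simple? t) (extensions m w)                        ≡⟨ sum-map-map _ (λ j → extend m j w) (upTo (suc m)) ⟩
  count (λ j → Simple? t (extend m j w)) (upTo (suc m))     ≤⟨ count-mono (λ j → Simple? t (extend m j w)) (λ j → Simple? j w)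
                                                                      (All.universal (λ j → Simple-extend⁻ j w w≤m) (upTo (suc m))) ⟩
  count (λ j → Simple? j w) (upTo (suc m))                  ∎
  where open ≤-Reasoning

simpleCount-suc-≤ : ∀ m t → simpleCount (suc m) t ≤ simpleCount m t + sum (map (simpleCount m) (upTo (suc m)))
simpleCount-suc-≤ m t = begin
  simpleCount (suc m) t
    ≡⟨ simpleCount-suc m t ⟩
  simpleCount m t + sum (map (λ w → count (Simple? t) (extensions m w)) (canon m))
    ≤⟨ +-monoʳ-≤ (simpleCount m t) (sum-map-mono (All.map (count-extensions≤ m t) (canon-Letters≤ m))) ⟩
  simpleCount m t + sum (map (λ w → count (λ j → Simple? j w) (upTo (suc m))) (canon m))
    ≡⟨ cong (simpleCount m t +_) (sum-map-swap (λ w j → indicator (Simple? j w)) (canon m) (upTo (suc m))) ⟩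
  simpleCount m t + sum (map (simpleCount m) (upTo (suc m))) ∎
  where open ≤-Reasoning

count-extensions≡0 : ∀ m t w → t ≤ m → count (Simple? t) (extensions m w) ≡ 0
count-extensions≡0 m t w t≤m = count-none (Simple? t)
  (All.map⁺ (All.universal (λ j simple → <⇒≱ (Simple-extend⇒< j w simple) t≤m) (upTo (suc m))))

simpleCount-suc-≡ : ∀ m t → t ≤ m → simpleCount (suc m) t ≡ simpleCount m t
simpleCount-suc-≡ m t t≤m = begin
  simpleCount (suc m) t
    ≡⟨ simpleCount-suc m t ⟩
  simpleCount m t + sum (map (λ w → count (Simple? t) (extensions m w)) (canon m))
    ≡⟨ cong (simpleCount m t +_) (sum-map-zero (All.universal (λ w → count-extensions≡0 m t w t≤m) (canon m))) ⟩
  simpleCount m t + 0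
    ≡⟨ +-identityʳ _ ⟩
  simpleCount m t ∎
  where open ≡-Reasoning

simpleCount≤3^ : ∀ m t → simpleCount m t ≤ 3 ^ (m ⊓ t)
simpleCount≤3^ zero    t = indicator≤1 (Simple? t [])
simpleCount≤3^ (suc m) t with t ≤? m
... | yes t≤m = begin
  simpleCount (suc m) t  ≡⟨ simpleCount-suc-≡ m t t≤m ⟩
  simpleCount m t        ≤⟨ simpleCount≤3^ m t ⟩
  3 ^ (m ⊓ t)            ≡⟨ cong (3 ^_) (trans (m≥n⇒m⊓n≡n t≤m) (sym (m≥n⇒m⊓n≡n (m≤n⇒m≤1+n t≤m)))) ⟩
  3 ^ (suc m ⊓ t)        ∎
  where open ≤-Reasoning
... | no t≰m = begin
  simpleCount (suc m) t                                       ≤⟨ simpleCount-suc-≤ m t ⟩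
  simpleCount m t + sum (map (simpleCount m) (upTo (suc m)))  ≤⟨ +-mono-≤ (≤-trans (simpleCount≤3^ m t) (^-monoʳ-≤ 3 (m⊓n≤m m t)))
                                                                          (sum-map-mono (All.applyUpTo⁺₁ (λ i → i) (suc m) below)) ⟩
  3 ^ m + sum (map (3 ^_) (upTo (suc m)))                     ≤⟨ geometric-3-bound m ⟩
  3 ^ suc m                                                   ≡⟨ cong (3 ^_) (sym (m≤n⇒m⊓n≡m (≰⇒> t≰m))) ⟩
  3 ^ (suc m ⊓ t)                                             ∎
  where
  open ≤-Reasoning
  below : ∀ {j} → j < suc m → simpleCount m j ≤ 3 ^ j
  below {j} (s≤s j≤m) = subst (λ e → simpleCount m j ≤ 3 ^ e) (m≥n⇒m⊓n≡n j≤m) (simpleCount≤3^ m j)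

bS-suc≤3^ : ∀ m → bS (suc m) ≤ 3 ^ m
bS-suc≤3^ m = begin
  bS (suc m)                                   ≤⟨ List.length-deduplicate (List.≡-dec _≟_) (map (oneLine (suc m) ∘ ⟦_⟧) simple) ⟩
  length (map (oneLine (suc m) ∘ ⟦_⟧) simple)  ≡⟨ List.length-map (oneLine (suc m) ∘ ⟦_⟧) simple ⟩
  length simple                                ≡⟨ length-filter≡count unique-letters? (canon m) ⟩
  count unique-letters? (canon m)              ≤⟨ count-mono unique-letters? (Simple? m) (All.map (λ w≤m u → u , w≤m) (canon-Letters≤ m)) ⟩
  simpleCount m m                              ≤⟨ simpleCount≤3^ m m ⟩
  3 ^ (m ⊓ m)                                  ≡⟨ cong (3 ^_) (⊓-idem m) ⟩
  3 ^ m                                        ∎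
  where
  open ≤-Reasoning
  unique-letters? = λ w → unique? (letters w)
  simple = filter unique-letters? (canon m)

3^n≤n! : ∀ {n} → 7 ≤ n → 3 ^ n ≤ n !
3^n≤n! {n} 7≤n = subst (λ n → 3 ^ n ≤ n !) (m+[n∸m]≡n 7≤n) (from7 (n ∸ 7))
  where
  from7 : ∀ k → 3 ^ (7 + k) ≤ (7 + k) !
  from7 zero    = ≤ᵇ⇒≤ (3 ^ 7) (7 !) _
  from7 (suc k) = *-mono-≤ {3} {8 + k} (s≤s (s≤s (s≤s z≤n))) (from7 k)

bS-rare : ∀ m n → 8 + m ≤ n → m * bS n < n !
bS-rare m (suc k) (s≤s 7+m≤k) = begin-strict
  m * bS (suc k)   ≤⟨ *-monoʳ-≤ m (bS-suc≤3^ k) ⟩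
  m * 3 ^ k        <⟨ *-monoˡ-< (3 ^ k) {{m^n≢0 3 k}} (s≤s (≤-trans (m≤n+m m 7) 7+m≤k)) ⟩
  suc k * 3 ^ k    ≤⟨ *-monoʳ-≤ (suc k) (3^n≤n! (≤-trans (m≤m+n 7 m) 7+m≤k)) ⟩
  suc k * k !      ∎
  where open ≤-Reasoning

-- Products of commuting transpositions

≡ᵇ-false : ∀ {x y} → x ≢ y → (x ≡ᵇ y) ≡ false
≡ᵇ-false {x} {y} = dec-false (x ≟ y)

≡ᵇ-refl : ∀ x → (x ≡ᵇ x) ≡ true
≡ᵇ-refl x = dec-true (x ≟ x) refl

τ-fix : ∀ {i x} → x ≢ i → x ≢ suc i → τ i x ≡ x
τ-fix x≢i x≢1+i rewrite ≡ᵇ-false x≢i | ≡ᵇ-false x≢1+i = refl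

τ-suc : ∀ k → τ k (suc k) ≡ k
τ-suc k rewrite ≡ᵇ-false (1+n≢n {k}) | ≡ᵇ-refl k = refl

evalWord-fix : ∀ {x} is → All (λ i → suc i < x) is → evalWord is x ≡ x
evalWord-fix []       []             = refl
evalWord-fix (i ∷ is) (1+i<x ∷ rest) rewrite evalWord-fix is rest =
  τ-fix (>⇒≢ (<-trans (n<1+n i) 1+i<x)) (>⇒≢ 1+i<x)

⟦⟧-fix : ∀ {m x} w → Letters≤ m w → 2 + m ≤ x → ⟦ w ⟧ x ≡ x
⟦⟧-fix w w≤m 2+m≤x = evalWord-fix (letters w) (All.map (λ i≤m → ≤-trans (s≤s (s≤s i≤m)) 2+m≤x) w≤m)

oneLine-≡⇒≡ : ∀ {n f g y} → oneLine n f ≡ oneLine n g → y < n → f (suc y) ≡ g (suc y)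
oneLine-≡⇒≡ {n} {f} {g} eq =
  applyUpTo-≡⇒≡ (f ∘ suc) (g ∘ suc) n (trans (sym (List.map-upTo (f ∘ suc) n)) (trans eq (List.map-upTo (g ∘ suc) n)))

push : ℕ → List (ℕ × ℕ) → List (ℕ × ℕ)
push m = extend (suc m) (suc m)

letters-push : ∀ m w → letters (push m w) ≡ letters w ++ [ 2 + m ]
letters-push m w = trans (letters-extend (suc m) (suc m) w) (cong (letters w ++_) (D-self (2 + m)))

⟦push⟧-below : ∀ {m y} w → y ≤ m → ⟦ push m w ⟧ (suc y) ≡ ⟦ w ⟧ (suc y)
⟦push⟧-below {m} {y} w y≤m rewrite letters-push m w | evalWord-++ (letters w) [ 2 + m ] (suc y) =
  cong ⟦ w ⟧ (τ-fix (<⇒≢ (s≤s (s≤s y≤m))) (<⇒≢ (s≤s (s≤s (m≤n⇒m≤1+n y≤m)))))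

⟦push⟧-top : ∀ {m} w → Letters≤ m w → ⟦ push m w ⟧ (3 + m) ≡ 2 + m
⟦push⟧-top {m} w w≤m rewrite letters-push m w | evalWord-++ (letters w) [ 2 + m ] (3 + m) | τ-suc (2 + m) =
  ⟦⟧-fix w w≤m ≤-refl

sparseWords : ℕ → List (List (ℕ × ℕ))
sparseWords zero          = [ [] ]
sparseWords (suc zero)    = [ [] ]
sparseWords (suc (suc m)) = sparseWords m ++ map (push m) (sparseWords m)

sparseWords-canon : ∀ m → All (_∈ canon m) (sparseWords m)
sparseWords-canon zero          = here refl ∷ []
sparseWords-canon (suc zero)    = canon-⊆-suc 0 (here refl) ∷ []
sparseWords-canon (suc (suc m)) =
  All.++⁺ (All.map (λ w∈ → canon-⊆-suc (suc m) (canon-⊆-suc m w∈)) (sparseWords-canon m))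
          (All.map⁺ (All.map (λ w∈ → extend-∈-canon ≤-refl (canon-⊆-suc m w∈)) (sparseWords-canon m)))

sparseWords-Letters≤ : ∀ m → All (Letters≤ m) (sparseWords m)
sparseWords-Letters≤ m = All.map (All.lookup (canon-Letters≤ m)) (sparseWords-canon m)

sparseWords-unique : ∀ m → All (Unique ∘ letters) (sparseWords m)
sparseWords-unique zero          = [] ∷ []
sparseWords-unique (suc zero)    = [] ∷ []
sparseWords-unique (suc (suc m)) = All.++⁺ (sparseWords-unique m)
  (All.map⁺ (All.zipWith (λ {w} → unique-push w) (sparseWords-unique m , sparseWords-Letters≤ m)))
  where
  unique-push : ∀ w → Unique (letters w) × Letters≤ m w → Unique (letters (push m w))
  unique-push w (w! , w≤m) = subst Unique (sym (letters-push m w))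
    (Unique-∷ʳ w! (All.map (λ x≤m → <⇒≢ (s≤s (m≤n⇒m≤1+n x≤m))) w≤m))

DifferOn : ℕ → List (ℕ × ℕ) → List (ℕ × ℕ) → Set
DifferOn m u v = ∃[ y ] (y ≤ m × ⟦ u ⟧ (suc y) ≢ ⟦ v ⟧ (suc y))

-- Two words pushed by τ_{m+2} or not are told apart at m+3, which only τ_{m+2} moves.
sparseWords-differ : ∀ m → AllPairs (DifferOn m) (sparseWords m)
sparseWords-differ zero          = [] ∷ []
sparseWords-differ (suc zero)    = [] ∷ []
sparseWords-differ (suc (suc m)) =
  AllPairs.++⁺ (AllPairs.map (λ {u} {v} → widen {u} {v}) (sparseWords-differ m))
               (AllPairs.map⁺ (AllPairs.map (λ {u} {v} → both-pushed {u} {v}) (sparseWords-differ m)))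
               (All.map (λ {u} u≤m → All.map⁺ (All.map (λ {v} v≤m → one-pushed u v u≤m v≤m) (sparseWords-Letters≤ m)))
                        (sparseWords-Letters≤ m))
  where
  m≤2+m = ≤-trans (n≤1+n m) (n≤1+n (suc m))
  widen : ∀ {u v} → DifferOn m u v → DifferOn (2 + m) u v
  widen (y , y≤m , ne) = y , ≤-trans y≤m m≤2+m , ne
  both-pushed : ∀ {u v} → DifferOn m u v → DifferOn (2 + m) (push m u) (push m v)
  both-pushed {u} {v} (y , y≤m , ne) =
    y , ≤-trans y≤m m≤2+m , λ eq → ne (trans (sym (⟦push⟧-below u y≤m)) (trans eq (⟦push⟧-below v y≤m)))
  one-pushed : ∀ u v → Letters≤ m u → Letters≤ m v → DifferOn (2 + m) u (push m v)
  one-pushed u v u≤m v≤m = 2 + m , ≤-refl , λ eq →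
    1+n≢n (trans (sym (⟦⟧-fix u u≤m (n≤1+n _))) (trans eq (⟦push⟧-top v v≤m)))

sparsePerms : ℕ → List (List ℕ)
sparsePerms m = map (oneLine (suc m) ∘ ⟦_⟧) (sparseWords m)

sparsePerms-unique : ∀ m → Unique (sparsePerms m)
sparsePerms-unique m = AllPairs.map⁺
  (AllPairs.map (λ {u} {v} (y , y≤m , ne) eq → ne (oneLine-≡⇒≡ {f = ⟦ u ⟧} {g = ⟦ v ⟧} eq (s≤s y≤m)))
                (sparseWords-differ m))

sparsePerms-⊆-bSList : ∀ m → All (_∈ bSList (suc m)) (sparsePerms m)
sparsePerms-⊆-bSList m = All.map⁺ (All.zipWith ∈-bSList (sparseWords-canon m , sparseWords-unique m))
  where
  ∈-bSList : ∀ {w} → w ∈ canon m × Unique (letters w) → oneLine (suc m) ⟦ w ⟧ ∈ bSList (suc m)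
  ∈-bSList (w∈ , w!) = ∈-deduplicate⁺ (List.≡-dec _≟_)
    (∈-map⁺ (oneLine (suc m) ∘ ⟦_⟧) (∈-filter⁺ (λ w → unique? (letters w)) w∈ w!))

-- length (sparseWords m) = 2 ^ ⌊ m /2⌋, and (4/3)² < 2.
sparseWords-growth : ∀ m → 4 ^ suc m ≤ 2 * (3 ^ suc m * length (sparseWords m))
sparseWords-growth zero          = ≤ᵇ⇒≤ 4 6 _
sparseWords-growth (suc zero)    = ≤ᵇ⇒≤ 16 18 _
sparseWords-growth (suc (suc m)) = begin
  4 * (4 * 4 ^ suc m)                        ≤⟨ *-monoʳ-≤ 4 (*-monoʳ-≤ 4 (sparseWords-growth m)) ⟩
  4 * (4 * (2 * (c * L)))                    ≤⟨ m≤m+n _ (4 * (c * L)) ⟩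
  4 * (4 * (2 * (c * L))) + 4 * (c * L)      ≡⟨ regroup c L ⟩
  2 * (3 * (3 * c) * (L + L))                ≡⟨ cong (λ l → 2 * (3 * (3 * c) * l)) length-double ⟩
  2 * (3 * (3 * c) * length (sparseWords (2 + m)))  ∎
  where
  open ≤-Reasoning
  c = 3 ^ suc m
  L = length (sparseWords m)
  length-double : L + L ≡ length (sparseWords (2 + m))
  length-double = sym (trans (List.length-++ (sparseWords m)) (cong (L +_) (List.length-map (push m) (sparseWords m))))
  regroup : ∀ c L → 4 * (4 * (2 * (c * L))) + 4 * (c * L) ≡ 2 * (3 * (3 * c) * (L + L))
  regroup = solve-∀

bS-lower : ∀ m → 4 ^ suc m ≤ 2 * (3 ^ suc m * bS (suc m))
bS-lower m = ≤-trans (sparseWords-growth m) (*-monoʳ-≤ 2 (*-monoʳ-≤ (3 ^ suc m) (begin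
  length (sparseWords m)   ≡⟨ List.length-map (oneLine (suc m) ∘ ⟦_⟧) (sparseWords m) ⟨
  length (sparsePerms m)   ≤⟨ Unique⇒length≤ (sparsePerms-unique m) (sparsePerms-⊆-bSList m) ⟩
  bS (suc m)               ∎)))
  where open ≤-Reasoning

corollary2p2 :
    (∀ (m : ℕ) → ∃[ N ] (∀ (n : ℕ) → N ≤ n → m * bS n < n !))
    ×
    (∃[ a₁ ] ∃[ a₂ ] ∃[ b₁ ] ∃[ b₂ ]
      (1 ≤ a₁ × 1 ≤ a₂ × 1 ≤ b₂ × b₂ < b₁ ×
       (∀ (n : ℕ) → 1 ≤ n → a₁ * b₁ ^ n ≤ a₂ * (b₂ ^ n * bS n))))
corollary2p2 = rare , (1 , 2 , 4 , 3 , ≤-refl , s≤s z≤n , s≤s z≤n , n<1+n 3 , growth)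
  where
  rare : ∀ m → ∃[ N ] (∀ n → N ≤ n → m * bS n < n !)
  rare m = 8 + m , bS-rare m
  growth : ∀ n → 1 ≤ n → 1 * 4 ^ n ≤ 2 * (3 ^ n * bS n)
  growth (suc m) _ = subst (_≤ 2 * (3 ^ suc m * bS (suc m))) (sym (*-identityˡ (4 ^ suc m))) (bS-lower m)
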